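{- Let $r,s$ be integers with $1\le s<r-1$, $\gcd(r,s)=\gcd(r,s+1)=1$, such that $\frac1r(1,s)$, $\frac1r(1,r-s)$ and $\frac1r(1,r-s-1)$ are R-singularities. Then the three cones representing $\frac{1}{r}(1,s)$, $\frac{1}{r}(1,r-s)$ and $\frac{1}{r}(1,r-s-1)$ are all isomorphic if and only if $(r,s)=(5,2)$.
   Context: The cyclic quotient singularity $\frac1r(1,s)$ ($r>0$, $0\le s<r$, $\gcd(r,s)=1$) is represented by the cone in $\mathbb{R}^2$ spanned by $(0,1)$ and $(r,-s)$; two such cones are isomorphic if they are $\mathrm{GL}_2(\mathbb{Z})$-equivalent, which for $\frac1r(1,s)$ and $\frac1r(1,s')$ holds iff $s'=s$ or $ss'\equiv 1\pmod r$. For a cone with primitive ray generators $\rho_1,\rho_2$, the lattice length $\ell$ is the number of lattice points on the segment $[\rho_1,\rho_2]$ minus one, and the height $h$ is the lattice distance from the origin to the line through $\rho_1,\rho_2$; the cone (singularity) is an R-cone (R-singularity) if $\ell<h$. -}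

module Defs where

open import Data.Nat as ℕ using (ℕ; suc)
open import Data.Nat.GCD using (gcd)
open import Data.Integer using (ℤ; +_; -_; _+_; _-_; _*_; ∣_∣)
open import Data.Product using (_×_; _,_; Σ; ∃)
open import Data.Sum using (_⊎_)
open import Data.List using (List; length)
open import Data.List.Membership.Propositional using (_∈_)
open import Data.List.Relation.Unary.Unique.Propositional using (Unique)
open import Relation.Binary.PropositionalEquality using (_≡_)
open import Function.Bundles using (_⇔_)

V : Set
V = ℤ × ℤ

_⊕_ : V → V → V
(a , b) ⊕ (c , d) = (a + c , b + d)

_⊖_ : V → V → V
(a , b) ⊖ (c , d) = (a - c , b - d)

_⊛_ : ℤ → V → V
k ⊛ (a , b) = (k * a , k * b)

Primitive : V → Set
Primitive (x , y) = gcd ∣ x ∣ ∣ y ∣ ≡ 1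

-- a 2-dimensional cone, given by its two primitive ray generators
Cone : Set
Cone = V × V

-- p lies on the closed segment [ρ₁,ρ₂]:  p = ρ₁ + (a/b)(ρ₂ - ρ₁) with 0 ≤ a ≤ b, b > 0
OnSegment : V → V → V → Set
OnSegment ρ₁ ρ₂ p = Σ ℕ λ a → Σ ℕ λ b →
  (1 ℕ.≤ b) × (a ℕ.≤ b) × ((+ b) ⊛ (p ⊖ ρ₁) ≡ (+ a) ⊛ (ρ₂ ⊖ ρ₁))

IsLatticeLength : V → V → ℕ → Set
IsLatticeLength ρ₁ ρ₂ ℓ = Σ (List V) λ ps →
  Unique ps × (∀ p → (p ∈ ps) ⇔ OnSegment ρ₁ ρ₂ p) × (length ps ≡ suc ℓ)

-- h is the lattice distance from the origin to the line through ρ₁,ρ₂: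
-- the line is {v | ⟨u,v⟩ = h} for a primitive integral functional u
IsLatticeHeight : V → V → ℕ → Set
IsLatticeHeight (x₁ , y₁) (x₂ , y₂) h = Σ ℤ λ a → Σ ℤ λ b →
  (gcd ∣ a ∣ ∣ b ∣ ≡ 1) × (a * x₁ + b * y₁ ≡ + h) × (a * x₂ + b * y₂ ≡ + h)

IsRCone : Cone → Set
IsRCone (ρ₁ , ρ₂) = Σ ℕ λ ℓ → Σ ℕ λ h →
  IsLatticeLength ρ₁ ρ₂ ℓ × IsLatticeHeight ρ₁ ρ₂ h × (ℓ ℕ.< h)

-- the cone of the cyclic quotient singularity 1/r(1,s): spanned by (0,1) and (r,-s)
qcone : ℕ → ℕ → Cone
qcone r s = ((+ 0 , + 1) , (+ r , - (+ s)))

IsRSing : ℕ → ℕ → Set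
IsRSing r s = IsRCone (qcone r s)

record Mat : Set where
  constructor mat
  field a b c d : ℤ

app : Mat → V → V
app (mat a b c d) (x , y) = (a * x + b * y , c * x + d * y)

det : Mat → ℤ
det (mat a b c d) = a * d - b * c

ConeIso : Cone → Cone → Set
ConeIso (ρ₁ , ρ₂) (σ₁ , σ₂) = Σ Mat λ M →
  ((det M ≡ + 1) ⊎ (det M ≡ - (+ 1))) ×
  (((app M ρ₁ ≡ σ₁) × (app M ρ₂ ≡ σ₂)) ⊎ ((app M ρ₁ ≡ σ₂) × (app M ρ₂ ≡ σ₁)))

-- A unimodular map between the cones of 1/r(1,s) and 1/r(1,s') forces s' ≡ s or
-- s s' ≡ 1 (mod r).  Put t = r - s and u = t - 1.  Since t ≢ u, t u ≡ 1; then s u ≡ 1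
-- would give r u = (s + t) u ≡ 2, so s ≡ u, i.e. r ∣ 2s + 1, whence r = 2s + 1.
-- Now t = s + 1 ≢ s, so s (s + 1) ≡ 1, and 4 s (s + 1) = r² - 1 yields r ∣ 5.
-- Conversely, for (r, s) = (5, 2) the three isomorphisms are explicit matrices.
module Submission where

open import Defs
open import Data.Nat using (ℕ; _≤_; _<_; _+_; _∸_)
open import Data.Nat.GCD using (gcd)
open import Data.Product using (_×_)
open import Relation.Binary.PropositionalEquality using (_≡_)
open import Function.Bundles using (_⇔_)

open import Data.Nat using (zero; suc; s≤s; z≤n; _*_)
open import Data.Nat.Properties
  using (+-identityʳ; +-mono-≤; +-monoʳ-≤; +-mono-≤-<; m≤m+n; m≤n+m; <⇒≱; +-cancelʳ-≡; *-cancelˡ-≡; suc-injective)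
import Data.Nat.Divisibility as ℕ
open import Data.Nat.Divisibility using (divides-refl; >⇒∤)
open import Data.Integer as ℤ using (ℤ; +_; -_; 1ℤ)
open import Data.Integer.Divisibility.Signed
  using (_∣_; divides; ∣-refl; ∣⇒∣ᵤ; ∣n⇒∣m*n; ∣m∣n⇒∣m-n; ∣m∣n⇒∣m+n; ∣m⇒∣-m)
open import Data.Integer.Tactic.RingSolver using (solve-∀; solve)
open import Data.List using (_∷_; [])
open import Data.Product using (_,_; proj₂; map₁; map₂)
open import Data.Sum using (_⊎_; inj₁; inj₂; [_,_]′)
open import Function using (id)
open import Relation.Nullary using (¬_; contradiction)
open import Relation.Binary.PropositionalEquality using (refl; sym; trans; cong; subst; module ≡-Reasoning)
open import Function.Bundles using (mk⇔)

m∣n<m+m⇒n≡m : ∀ {m n} → m ℕ.∣ n → 0 < n → n < m + m → n ≡ m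
m∣n<m+m⇒n≡m (divides-refl 0) () _
m∣n<m+m⇒n≡m {m} (divides-refl 1) _ _ = +-identityʳ m
m∣n<m+m⇒n≡m {m} (divides-refl (suc (suc q))) _ n<m+m =
  contradiction (+-monoʳ-≤ m (m≤m+n m (q * m))) (<⇒≱ n<m+m)

n+n≡4⇒n≡2 : ∀ {n} → n + n ≡ 4 → n ≡ 2
n+n≡4⇒n≡2 {n} n+n≡4 = *-cancelˡ-≡ n 2 2 (trans (cong (_+_ n) (+-identityʳ n)) n+n≡4)

infix 4 _≡_mod_ _≅_mod_

_≡_mod_ : ℤ → ℤ → ℕ → Set
_≡_mod_ x y r = + r ∣ x ℤ.- y

-- The arithmetic form of 1/r(1,x) ≅ 1/r(1,y).
_≅_mod_ : ℤ → ℤ → ℕ → Set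
_≅_mod_ x y r = x ≡ y mod r ⊎ x ℤ.* y ≡ 1ℤ mod r

≡-mod-sym : ∀ {r x y} → x ≡ y mod r → y ≡ x mod r
≡-mod-sym {x = x} {y} r∣x-y = subst (_ ∣_) (algebra x y) (∣m⇒∣-m r∣x-y)
  where
  algebra : ∀ x y → - (x ℤ.- y) ≡ y ℤ.- x
  algebra = solve-∀

x≢1+x-mod : ∀ {r} x → 1 < r → ¬ (x ≡ 1ℤ ℤ.+ x mod r)
x≢1+x-mod x 1<r r∣x-[1+x] = >⇒∤ 1<r (∣⇒∣ᵤ (subst (_ ∣_) (algebra x) r∣x-[1+x]))
  where
  algebra : ∀ x → x ℤ.- (1ℤ ℤ.+ x) ≡ - 1ℤ
  algebra = solve-∀

proj₂-app-e₂≡d : ∀ M → proj₂ (app M (+ 0 , 1ℤ)) ≡ Mat.d M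
proj₂-app-e₂≡d (mat a b c d) = begin
  c ℤ.* + 0 ℤ.+ d ℤ.* 1ℤ  ≡⟨ solve (c ∷ d ∷ []) ⟩
  d                       ∎
  where open ≡-Reasoning

qcone-iso⇒≅ : ∀ {r s s'} → ConeIso (qcone r s) (qcone r s') → + s ≅ + s' mod r
qcone-iso⇒≅ {r} {s} {s'} (M@(mat a b c d) , _ , inj₁ (e₁ , e₂)) = inj₁ (divides c (begin
  + s ℤ.- + s'                           ≡⟨ cong (λ y → + s ℤ.+ y) (sym (cong proj₂ e₂)) ⟩
  + s ℤ.+ (c ℤ.* + r ℤ.+ d ℤ.* - + s)    ≡⟨ cong (λ d → + s ℤ.+ (c ℤ.* + r ℤ.+ d ℤ.* - + s)) d≡1 ⟩
  + s ℤ.+ (c ℤ.* + r ℤ.+ 1ℤ ℤ.* - + s)   ≡⟨ algebra c (+ r) (+ s) ⟩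
  c ℤ.* + r                              ∎))
  where
  open ≡-Reasoning
  algebra : ∀ c R S → S ℤ.+ (c ℤ.* R ℤ.+ 1ℤ ℤ.* - S) ≡ c ℤ.* R
  algebra = solve-∀
  d≡1 : d ≡ 1ℤ
  d≡1 = trans (sym (proj₂-app-e₂≡d M)) (cong proj₂ e₁)
qcone-iso⇒≅ {r} {s} {s'} (M@(mat a b c d) , _ , inj₂ (e₁ , e₂)) = inj₂ (divides (- c) (begin
  + s ℤ.* + s' ℤ.- 1ℤ                                     ≡⟨ cong (λ y → + s ℤ.* + s' ℤ.- y) (sym (cong proj₂ e₂)) ⟩
  + s ℤ.* + s' ℤ.- (c ℤ.* + r ℤ.+ d ℤ.* - + s)            ≡⟨ cong (λ d → + s ℤ.* + s' ℤ.- (c ℤ.* + r ℤ.+ d ℤ.* - + s)) d≡-s' ⟩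
  + s ℤ.* + s' ℤ.- (c ℤ.* + r ℤ.+ - + s' ℤ.* - + s)       ≡⟨ algebra c (+ r) (+ s) (+ s') ⟩
  - c ℤ.* + r                                             ∎))
  where
  open ≡-Reasoning
  algebra : ∀ c R S S' → S ℤ.* S' ℤ.- (c ℤ.* R ℤ.+ - S' ℤ.* - S) ≡ - c ℤ.* R
  algebra = solve-∀
  d≡-s' : d ≡ - + s'
  d≡-s' = trans (sym (proj₂-app-e₂≡d M)) (cong proj₂ e₁)

-- Below, r = s + u + 1, so that u = r - s - 1 and t = u + 1 = r - s.

su≡1-mod⇒tu≢1-mod : ∀ s u → 2 < suc (s + u) →
  + s ℤ.* + u ≡ 1ℤ mod suc (s + u) → ¬ (+ suc u ℤ.* + u ≡ 1ℤ mod suc (s + u))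
su≡1-mod⇒tu≢1-mod s u 2<r su≡1 tu≡1 =
  >⇒∤ 2<r (∣⇒∣ᵤ (subst (+ suc (s + u) ∣_) (algebra (+ s) (+ u))
    (∣m∣n⇒∣m-n (∣n⇒∣m*n (+ u) ∣-refl) (∣m∣n⇒∣m+n su≡1 tu≡1))))
  where
  algebra : ∀ S U → U ℤ.* (1ℤ ℤ.+ (S ℤ.+ U)) ℤ.- ((S ℤ.* U ℤ.- 1ℤ) ℤ.+ ((1ℤ ℤ.+ U) ℤ.* U ℤ.- 1ℤ)) ≡ + 2
  algebra = solve-∀

s≡u-mod⇒u≡s : ∀ s u → + s ≡ + u mod suc (s + u) → u ≡ s
s≡u-mod⇒u≡s s u r∣s-u = +-cancelʳ-≡ u u s (suc-injective (m∣n<m+m⇒n≡m r∣1+2u (s≤s z≤n) 1+2u<r+r))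
  where
  algebra : ∀ S U → (1ℤ ℤ.+ (S ℤ.+ U)) ℤ.- (S ℤ.- U) ≡ 1ℤ ℤ.+ (U ℤ.+ U)
  algebra = solve-∀
  r∣1+2u : suc (s + u) ℕ.∣ suc (u + u)
  r∣1+2u = ∣⇒∣ᵤ (subst (+ suc (s + u) ∣_) (algebra (+ s) (+ u)) (∣m∣n⇒∣m-n ∣-refl r∣s-u))
  u<r : u < suc (s + u)
  u<r = s≤s (m≤n+m u s)
  1+2u<r+r : suc (u + u) < suc (s + u) + suc (s + u)
  1+2u<r+r = +-mono-≤-< u<r u<r

s≅1+s-mod⇒1+2s≡5 : ∀ s → 1 ≤ s → + s ≅ + suc s mod suc (s + s) → suc (s + s) ≡ 5
s≅1+s-mod⇒1+2s≡5 s 1≤s (inj₁ s≡1+s) = contradiction s≡1+s (x≢1+x-mod (+ s) (s≤s (+-mono-≤ 1≤s z≤n)))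
s≅1+s-mod⇒1+2s≡5 s 1≤s (inj₂ s[1+s]≡1) = sym (m∣n<m+m⇒n≡m r∣5 (s≤s z≤n) (+-mono-≤ 3≤r 3≤r))
  where
  3≤r : 3 ≤ suc (s + s)
  3≤r = s≤s (+-mono-≤ 1≤s 1≤s)
  algebra : ∀ S → (1ℤ ℤ.+ (S ℤ.+ S)) ℤ.* (1ℤ ℤ.+ (S ℤ.+ S)) ℤ.- + 4 ℤ.* (S ℤ.* (1ℤ ℤ.+ S) ℤ.- 1ℤ) ≡ + 5
  algebra = solve-∀
  r∣5 : suc (s + s) ℕ.∣ 5
  r∣5 = ∣⇒∣ᵤ (subst (+ suc (s + s) ∣_) (algebra (+ s))
    (∣m∣n⇒∣m-n (∣n⇒∣m*n (+ suc (s + s)) ∣-refl) (∣n⇒∣m*n (+ 4) s[1+s]≡1)))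

t≅u∧s≅u-mod⇒u≡s : ∀ s u → 1 ≤ s → 1 ≤ u →
  + suc u ≅ + u mod suc (s + u) → + s ≅ + u mod suc (s + u) → u ≡ s
t≅u∧s≅u-mod⇒u≡s s u 1≤s 1≤u t≅u s≅u = s≡u-mod⇒u≡s s u s≡u
  where
  2<r : 2 < suc (s + u)
  2<r = s≤s (+-mono-≤ 1≤s 1≤u)
  1<r : 1 < suc (s + u)
  1<r = s≤s (+-mono-≤ 1≤s z≤n)
  tu≡1 : + suc u ℤ.* + u ≡ 1ℤ mod suc (s + u)
  tu≡1 = [ (λ t≡u → contradiction (≡-mod-sym {x = + suc u} {+ u} t≡u) (x≢1+x-mod (+ u) 1<r)) , id ]′ t≅u
  s≡u : + s ≡ + u mod suc (s + u)
  s≡u = [ id , (λ su≡1 → contradiction tu≡1 (su≡1-mod⇒tu≢1-mod s u 2<r su≡1)) ]′ s≅u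

≅-triple⇒r≡5∧s≡2 : ∀ {r s t u} → r ≡ suc (s + u) → t ≡ suc u → 1 ≤ s → 1 ≤ u →
  + s ≅ + t mod r → + t ≅ + u mod r → + s ≅ + u mod r → r ≡ 5 × s ≡ 2
≅-triple⇒r≡5∧s≡2 {s = s} {u = u} refl refl 1≤s 1≤u s≅t t≅u s≅u =
  subst (λ u → suc (s + u) ≡ 5) (sym u≡s) 1+2s≡5 , n+n≡4⇒n≡2 (suc-injective 1+2s≡5)
  where
  u≡s : u ≡ s
  u≡s = t≅u∧s≅u-mod⇒u≡s s u 1≤s 1≤u t≅u s≅u
  1+2s≡5 : suc (s + s) ≡ 5
  1+2s≡5 = s≅1+s-mod⇒1+2s≡5 s 1≤s (subst (λ u → + s ≅ + suc u mod suc (s + u)) u≡s s≅t)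

m<n∸1⇒decomposition : ∀ m n → m < n ∸ 1 →
  1 ≤ n ∸ m ∸ 1 × n ≡ suc (m + (n ∸ m ∸ 1)) × n ∸ m ≡ suc (n ∸ m ∸ 1)
m<n∸1⇒decomposition zero (suc n) 0<n = 0<n , refl , refl
m<n∸1⇒decomposition (suc m) (suc (suc n)) (s≤s m<n) =
  map₂ (map₁ (cong suc)) (m<n∸1⇒decomposition m (suc n) m<n)

-- 1/5(1,2) ≅ 1/5(1,3) because 2 · 3 ≡ 1 (mod 5).
qcone-5-2-isos :
  ConeIso (qcone 5 2) (qcone 5 3) × ConeIso (qcone 5 3) (qcone 5 2) × ConeIso (qcone 5 2) (qcone 5 2)
qcone-5-2-isos =
  (mat (+ 2) (+ 5) (- 1ℤ) (- + 3) , inj₂ refl , inj₂ (refl , refl)) ,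
  (mat (+ 3) (+ 5) (- 1ℤ) (- + 2) , inj₂ refl , inj₂ (refl , refl)) ,
  (mat 1ℤ (+ 0) (+ 0) 1ℤ , inj₁ refl , inj₁ (refl , refl))

lemma4p4 : (r s : ℕ) → 1 ≤ s → s < r ∸ 1 → gcd r s ≡ 1 → gcd r (s + 1) ≡ 1 →
    IsRSing r s → IsRSing r (r ∸ s) → IsRSing r (r ∸ s ∸ 1) →
    ((ConeIso (qcone r s) (qcone r (r ∸ s)) ×
      ConeIso (qcone r (r ∸ s)) (qcone r (r ∸ s ∸ 1)) ×
      ConeIso (qcone r s) (qcone r (r ∸ s ∸ 1)))
     ⇔ (r ≡ 5 × s ≡ 2))
lemma4p4 r s 1≤s s<r∸1 _ _ _ _ _ with m<n∸1⇒decomposition s r s<r∸1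
... | 1≤u , r≡1+s+u , r∸s≡1+u = mk⇔
  (λ (i₁ , i₂ , i₃) → ≅-triple⇒r≡5∧s≡2 r≡1+s+u r∸s≡1+u 1≤s 1≤u
    (qcone-iso⇒≅ i₁) (qcone-iso⇒≅ i₂) (qcone-iso⇒≅ i₃))
  (λ { (refl , refl) → qcone-5-2-isos })
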